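{- Let $0<\alpha<1$ and $\beta=1-\alpha$. Consider the Markov chain on the state space consisting of upper states $U_0,U_1,U_2,\dots$, lower states $L_0,L_1,L_2,\dots$, and two extra states $P$ and $Q$, with transition probabilities: - from $U_i$, $i$ even: to $U_{i+1}$ with probability $\alpha$, to $U_{i-1}$ with probability $\beta$ if $i\ge2$, and from $U_0$ to $P$ with probability $\beta$; - from $U_i$, $i$ odd: to $U_{i+1}$ with probability $\beta$, to $U_{i-1}$ with probability $\alpha$; - from $P$: to $U_0$ with probability $\beta$, to $L_1$ with probability $\alpha$; - from $L_i$, $i$ even: to $L_{i+1}$ with probability $\beta$, to $L_{i-1}$ with probability $\alpha$ if $i\ge 2$, and from $L_0$ to $Q$ with probability $\alpha$; - from $L_i$, $i$ odd: to $L_{i+1}$ with probability $\alpha$, to $L_{i-1}$ with probability $\beta$; - from $Q$: to $L_0$ with probability $\alpha$, to $U_1$ with probability $\beta$. The chain starts at $X_0=U_0$. Let $$E(z)=\sum_{m\ge0}\Big(\sum_{k\ge0}2k\,\mathbb{P}\{X_{2m}=U_{2k}\}+\sum_{k\ge0}(2k+1)\,\mathbb{P}\{X_{2m}=L_{2k+1}\}\Big)z^m .$$ Let $v=v(z)$ be the unique formal power series with $v(0)=0$ satisfying $z=\dfrac{v}{(\alpha+\beta v)(\beta+\alpha v)}$. Then $$E(z)=\frac{v(v\alpha+\beta)(3v^2\beta+3\alpha+3v\beta+v\alpha+\alpha v^2+\alpha v^3)}{\alpha\beta(1-v)^3(1+v+v^2)}.$$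
   Context: $\mathbb{P}\{X_{2m}=S\}$ denotes the probability that the chain started at $U_0$ is in state $S$ after exactly $2m$ steps. After an even number of steps the chain can only be in states $U_{2k}$, $L_{2k+1}$ or $Q$; the coefficient of $z^m$ in $E(z)$ is the expected index of the final state after $2m$ steps, with $Q$ contributing index $0$.
   Formalization: The parameter α ranges over the rationals with $0<\alpha<1$, and the power series, including $v$, are taken over ℚ. -}

module Defs where

open import Data.Nat as ℕ using (ℕ; zero; suc; _∸_)
import Data.Nat.Properties as ℕP
open import Data.Integer using (+_)
open import Data.Rational using (ℚ; 0ℚ; 1ℚ; _+_; _*_; _-_; _/_)
open import Data.List using (List; []; _∷_; _++_; concatMap; map)
open import Data.Product using (_×_; _,_)
open import Data.Bool using (Bool; true; false; if_then_else_)
open import Relation.Binary.PropositionalEquality using (_≡_)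

ℕ→ℚ : ℕ → ℚ
ℕ→ℚ n = + n / 1

isEven : ℕ → Bool
isEven zero = true
isEven (suc zero) = false
isEven (suc (suc n)) = isEven n

data State : Set where
  U : ℕ → State
  L : ℕ → State
  P : State
  Q : State

-- Transitions from a state (α, β given explicitly; the paper has β = 1 - α).
-- A list of (target state, probability).
step : ℚ → ℚ → State → List (State × ℚ)
step α β (U zero)          = (U 1 , α) ∷ (P , β) ∷ []
step α β (U (suc i)) with isEven (suc i)
... | true  = (U (suc (suc i)) , α) ∷ (U i , β) ∷ []
... | false = (U (suc (suc i)) , β) ∷ (U i , α) ∷ []
step α β P                 = (U 0 , β) ∷ (L 1 , α) ∷ []
step α β (L zero)          = (L 1 , β) ∷ (Q , α) ∷ []
step α β (L (suc i)) with isEven (suc i)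
... | true  = (L (suc (suc i)) , β) ∷ (L i , α) ∷ []
... | false = (L (suc (suc i)) , α) ∷ (L i , β) ∷ []
step α β Q                 = (L 0 , α) ∷ (U 1 , β) ∷ []

-- Law of X_n for the chain started at X_0 = U_0, as a finite list of
-- (state, probability mass) entries (a state may occur several times;
-- P{X_n = s} is the total mass of the entries for s).
law : ℚ → ℚ → ℕ → List (State × ℚ)
law α β zero    = (U 0 , 1ℚ) ∷ []
law α β (suc n) = concatMap (λ { (s , p) → map (λ { (t , q) → (t , p * q) }) (step α β s) }) (law α β n)

weight : State → ℚ
weight (U i) = if isEven i then ℕ→ℚ i else 0ℚ
weight (L i) = if isEven i then 0ℚ else ℕ→ℚ i
weight P     = 0ℚ
weight Q     = 0ℚ

sumℚ : List ℚ → ℚ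
sumℚ []       = 0ℚ
sumℚ (x ∷ xs) = x + sumℚ xs

expectedWeight : ℚ → ℚ → ℕ → ℚ
expectedWeight α β n = sumℚ (map (λ { (s , p) → weight s * p }) (law α β n))

Series : Set
Series = ℕ → ℚ

E : ℚ → Series
E α m = expectedWeight α (1ℚ - α) (m ℕ.+ m)

const : ℚ → Series
const c zero    = c
const c (suc n) = 0ℚ

zS : Series
zS (suc zero) = 1ℚ
zS _          = 0ℚ

infixl 6 _⊕_ _⊖_
infixl 7 _⊛_

_⊕_ : Series → Series → Series
(f ⊕ g) n = f n + g n

_⊖_ : Series → Series → Series
(f ⊖ g) n = f n - g n

sumTo : ℕ → (ℕ → ℚ) → ℚ
sumTo zero    f = f 0
sumTo (suc n) f = sumTo n f + f (suc n)

_⊛_ : Series → Series → Series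
(f ⊛ g) n = sumTo n (λ i → f i * g (n ∸ i))

_·_ : ℚ → Series → Series
(c · f) n = c * f n
infixl 7 _·_

3ℚ : ℚ
3ℚ = ℕ→ℚ 3

-- Reading the chain backwards, the coefficient of zᵐ in E is (T²ᵐ weight)(U₀) for the transition operator T.
-- On the states reachable from U₀ in an even number of steps (U₂ₖ, L₂ₖ₊₁ and Q) the operator T² only couples
-- neighbours, so the generating functions Kₛ = Σₘ (T²ᵐ weight)(s) zᵐ satisfy Kₛ = weight(s) + z·(T² K)(s),
-- and this recursion determines them. It therefore suffices to exhibit series Yₛ solving the recursion
-- multiplied by the denominator D of the theorem. After a further multiplication by (α + βv)(β + αv), which
-- turns z into v, each instance is a polynomial identity in α and v, checked by the ring solver on power
-- series; the value at U₀ is the numerator.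
module Submission where

open import Defs
open import Data.Nat using (ℕ)
open import Data.Rational using (ℚ; 0ℚ; 1ℚ; _<_; _-_; _*_)
open import Relation.Binary.PropositionalEquality using (_≡_)

open import Level using (0ℓ)
open import Data.Nat as ℕ using (zero; suc; _∸_; _≤_; z≤n; s≤s)
import Data.Nat.Properties as ℕ
open import Data.Nat.Induction using (<-rec)
import Data.Nat.Coprimality as Coprime
import Data.Integer as ℤ
import Data.Integer.Properties as ℤ
open import Data.Rational as ℚ using (_+_; -_; _/_; 1/_; mkℚ)
import Data.Rational.Properties as ℚ
open import Data.Rational.Solver using (module +-*-Solver)
open import Data.Bool using (true; false)
open import Data.List using (List; []; _∷_; _++_; map; concatMap)
open import Data.Maybe using (just; nothing)
open import Data.Product using (_×_; _,_)
open import Data.Vec using ([]; _∷_)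
open import Data.Fin using (zero; suc)
open import Function using (_∘_)
open import Relation.Nullary using (yes; no)
open import Relation.Binary using (Setoid)
open import Relation.Binary.Definitions using (WeaklyDecidable)
open import Relation.Binary.PropositionalEquality as ≡ using (_≢_; refl; cong; cong₂)
import Relation.Binary.Reasoning.Setoid as SetoidReasoning
open import Algebra.Structures.Biased using (IsCommutativeSemiringˡ)
open import Algebra.Solver.Ring.AlmostCommutativeRing
  using (AlmostCommutativeRing; IsAlmostCommutativeRing; _-Raw-AlmostCommutative⟶_)
import Algebra.Solver.Ring
open import Algebra.Properties.Group ℚ.+-0-group using (∙-cancelʳ)

-- Formal power series as a commutative ring

infix 4 _≋_
record _≋_ (f g : Series) : Set where
  constructor mk≋
  field coeff≡ : ∀ n → f n ≡ g n
open _≋_ public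

≋-setoid : Setoid 0ℓ 0ℓ
≋-setoid = record
  { Carrier       = Series
  ; _≈_           = _≋_
  ; isEquivalence = record
    { refl  = mk≋ λ _ → refl
    ; sym   = λ p → mk≋ λ n → ≡.sym (coeff≡ p n)
    ; trans = λ p q → mk≋ λ n → ≡.trans (coeff≡ p n) (coeff≡ q n)
    }
  }

open Setoid ≋-setoid public using () renaming (refl to ≋-refl; sym to ≋-sym; trans to ≋-trans)

tail : Series → Series
tail f n = f (suc n)

0ₛ 1ₛ : Series
0ₛ = const 0ℚ
1ₛ = const 1ℚ

-ₛ_ : Series → Series
(-ₛ f) n = - f n

const-cong : ∀ {c d} → c ≡ d → const c ≋ const d
const-cong refl = ≋-refl

-- Cauchy product by recursion on the first factor, so that its laws follow by induction.
infixl 7 _⊗_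
_⊗_ : Series → Series → Series
(f ⊗ g) zero    = f 0 * g 0
(f ⊗ g) (suc n) = f 0 * g (suc n) + (tail f ⊗ g) n

sumTo-suc : ∀ n (h : ℕ → ℚ) → sumTo (suc n) h ≡ h 0 + sumTo n (h ∘ suc)
sumTo-suc zero    h = refl
sumTo-suc (suc n) h = ≡.trans (cong (_+ h (suc (suc n))) (sumTo-suc n h)) (ℚ.+-assoc (h 0) _ _)

⊛≗⊗ : ∀ f g n → (f ⊛ g) n ≡ (f ⊗ g) n
⊛≗⊗ f g zero    = refl
⊛≗⊗ f g (suc n) = ≡.trans (sumTo-suc n (λ i → f i * g (suc n ∸ i))) (cong (f 0 * g (suc n) +_) (⊛≗⊗ (tail f) g n))

⊗-cong : ∀ {f f′ g g′} → f ≋ f′ → g ≋ g′ → ∀ n → (f ⊗ g) n ≡ (f′ ⊗ g′) n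
⊗-cong p q zero    = cong₂ _*_ (coeff≡ p 0) (coeff≡ q 0)
⊗-cong p q (suc n) = cong₂ _+_ (cong₂ _*_ (coeff≡ p 0) (coeff≡ q (suc n))) (⊗-cong (mk≋ (coeff≡ p ∘ suc)) q n)

⊗-distribʳ-⊕ : ∀ f g h n → ((f ⊕ g) ⊗ h) n ≡ (f ⊗ h) n + (g ⊗ h) n
⊗-distribʳ-⊕ f g h zero    = ℚ.*-distribʳ-+ (h 0) (f 0) (g 0)
⊗-distribʳ-⊕ f g h (suc n) = ≡.trans (cong ((f 0 + g 0) * h (suc n) +_) (⊗-distribʳ-⊕ (tail f) (tail g) h n))
  (solve 5 (λ a b x u w → (a :+ b) :* x :+ (u :+ w) := (a :* x :+ u) :+ (b :* x :+ w)) refl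
     (f 0) (g 0) (h (suc n)) ((tail f ⊗ h) n) ((tail g ⊗ h) n))
  where open +-*-Solver

⊗-scaleˡ : ∀ c f g n → ((c · f) ⊗ g) n ≡ c * (f ⊗ g) n
⊗-scaleˡ c f g zero    = ℚ.*-assoc c (f 0) (g 0)
⊗-scaleˡ c f g (suc n) = ≡.trans (cong (c * f 0 * g (suc n) +_) (⊗-scaleˡ c (tail f) g n))
  (solve 4 (λ c a x u → c :* a :* x :+ c :* u := c :* (a :* x :+ u)) refl c (f 0) (g (suc n)) ((tail f ⊗ g) n))
  where open +-*-Solver

⊗-sucʳ : ∀ f g n → (f ⊗ g) (suc n) ≡ (f ⊗ tail g) n + f (suc n) * g 0
⊗-sucʳ f g zero    = refl
⊗-sucʳ f g (suc n) = ≡.trans (cong (f 0 * g (suc (suc n)) +_) (⊗-sucʳ (tail f) g n))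
  (≡.sym (ℚ.+-assoc (f 0 * g (suc (suc n))) _ _))

⊗-comm : ∀ f g n → (f ⊗ g) n ≡ (g ⊗ f) n
⊗-comm f g zero    = ℚ.*-comm (f 0) (g 0)
⊗-comm f g (suc n) = begin
  f 0 * g (suc n) + (tail f ⊗ g) n ≡⟨ cong₂ _+_ (ℚ.*-comm (f 0) _) (⊗-comm (tail f) g n) ⟩
  g (suc n) * f 0 + (g ⊗ tail f) n ≡⟨ ℚ.+-comm (g (suc n) * f 0) _ ⟩
  (g ⊗ tail f) n + g (suc n) * f 0 ≡⟨ ≡.sym (⊗-sucʳ g f n) ⟩
  (g ⊗ f) (suc n)                  ∎
  where open ≡.≡-Reasoning

⊗-assoc : ∀ f g h n → ((f ⊗ g) ⊗ h) n ≡ (f ⊗ (g ⊗ h)) n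
⊗-assoc f g h zero    = ℚ.*-assoc (f 0) (g 0) (h 0)
⊗-assoc f g h (suc n) = begin
  f 0 * g 0 * h (suc n) + (tail (f ⊗ g) ⊗ h) n
    ≡⟨ cong (f 0 * g 0 * h (suc n) +_) (⊗-distribʳ-⊕ (f 0 · tail g) (tail f ⊗ g) h n) ⟩
  f 0 * g 0 * h (suc n) + (((f 0 · tail g) ⊗ h) n + ((tail f ⊗ g) ⊗ h) n)
    ≡⟨ cong (f 0 * g 0 * h (suc n) +_) (cong₂ _+_ (⊗-scaleˡ (f 0) (tail g) h n) (⊗-assoc (tail f) g h n)) ⟩
  f 0 * g 0 * h (suc n) + (f 0 * (tail g ⊗ h) n + (tail f ⊗ (g ⊗ h)) n)
    ≡⟨ solve 5 (λ a b x u w → a :* b :* x :+ (a :* u :+ w) := a :* (b :* x :+ u) :+ w) refl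
         (f 0) (g 0) (h (suc n)) ((tail g ⊗ h) n) ((tail f ⊗ (g ⊗ h)) n) ⟩
  f 0 * (g 0 * h (suc n) + (tail g ⊗ h) n) + (tail f ⊗ (g ⊗ h)) n ∎
  where
  open ≡.≡-Reasoning
  open +-*-Solver

⊗-zeroˡ : ∀ f n → ((λ _ → 0ℚ) ⊗ f) n ≡ 0ℚ
⊗-zeroˡ f zero    = ℚ.*-zeroˡ (f 0)
⊗-zeroˡ f (suc n) = cong₂ _+_ (ℚ.*-zeroˡ (f (suc n))) (⊗-zeroˡ f n)

const-⊗ : ∀ c f n → (const c ⊗ f) n ≡ c * f n
const-⊗ c f zero    = refl
const-⊗ c f (suc n) = ≡.trans (cong (c * f (suc n) +_) (⊗-zeroˡ f n)) (ℚ.+-identityʳ _)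

⊗-negˡ : ∀ f g n → ((-ₛ f) ⊗ g) n ≡ - (f ⊗ g) n
⊗-negˡ f g zero    = ≡.sym (ℚ.neg-distribˡ-* (f 0) (g 0))
⊗-negˡ f g (suc n) = ≡.trans (cong (- f 0 * g (suc n) +_) (⊗-negˡ (tail f) g n))
  (solve 3 (λ a x u → :- a :* x :+ :- u := :- (a :* x :+ u)) refl (f 0) (g (suc n)) ((tail f ⊗ g) n))
  where open +-*-Solver

⊛-comm : ∀ f g → f ⊛ g ≋ g ⊛ f
⊛-comm f g = mk≋ λ n → ≡.trans (⊛≗⊗ f g n) (≡.trans (⊗-comm f g n) (≡.sym (⊛≗⊗ g f n)))

⊛-cong : ∀ {f f′ g g′} → f ≋ f′ → g ≋ g′ → f ⊛ g ≋ f′ ⊛ g′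
⊛-cong {f} {f′} {g} {g′} p q = mk≋ λ n → ≡.trans (⊛≗⊗ f g n) (≡.trans (⊗-cong p q n) (≡.sym (⊛≗⊗ f′ g′ n)))

const-⊛ : ∀ c f → const c ⊛ f ≋ c · f
const-⊛ c f = mk≋ λ n → ≡.trans (⊛≗⊗ (const c) f n) (const-⊗ c f n)

⊛-assoc : ∀ f g h → (f ⊛ g) ⊛ h ≋ f ⊛ (g ⊛ h)
⊛-assoc f g h = mk≋ λ n → begin
  ((f ⊛ g) ⊛ h) n  ≡⟨ ⊛≗⊗ (f ⊛ g) h n ⟩
  ((f ⊛ g) ⊗ h) n  ≡⟨ ⊗-cong (mk≋ (⊛≗⊗ f g)) ≋-refl n ⟩
  ((f ⊗ g) ⊗ h) n  ≡⟨ ⊗-assoc f g h n ⟩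
  (f ⊗ (g ⊗ h)) n  ≡⟨ ⊗-cong ≋-refl (≋-sym (mk≋ (⊛≗⊗ g h))) n ⟩
  (f ⊗ (g ⊛ h)) n  ≡⟨ ≡.sym (⊛≗⊗ f (g ⊛ h) n) ⟩
  (f ⊛ (g ⊛ h)) n  ∎
  where open ≡.≡-Reasoning

⊕-cong : ∀ {f f′ g g′} → f ≋ f′ → g ≋ g′ → f ⊕ g ≋ f′ ⊕ g′
⊕-cong p q = mk≋ λ n → cong₂ _+_ (coeff≡ p n) (coeff≡ q n)

isAlmostCommutativeRing : IsAlmostCommutativeRing _≋_ _⊕_ _⊛_ -ₛ_ 0ₛ 1ₛ
isAlmostCommutativeRing = record
  { isCommutativeSemiring = IsCommutativeSemiringˡ.isCommutativeSemiring record
    { +-isCommutativeMonoid = record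
      { isMonoid = record
        { isSemigroup = record
          { isMagma = record { isEquivalence = isEquivalence ; ∙-cong = ⊕-cong }
          ; assoc   = λ f g h → mk≋ λ n → ℚ.+-assoc (f n) (g n) (h n)
          }
        ; identity = (λ f → mk≋ λ n → ≡.trans (cong (_+ f n) (const0 n)) (ℚ.+-identityˡ (f n)))
                   , (λ f → mk≋ λ n → ≡.trans (cong (f n +_) (const0 n)) (ℚ.+-identityʳ (f n)))
        }
      ; comm = λ f g → mk≋ λ n → ℚ.+-comm (f n) (g n)
      }
    ; *-isCommutativeMonoid = record
      { isMonoid = record
        { isSemigroup = record
          { isMagma = record { isEquivalence = isEquivalence ; ∙-cong = ⊛-cong }
          ; assoc   = ⊛-assoc
          }
        ; identity = ⊛-identityˡ , (λ f → ≋-trans (⊛-comm f 1ₛ) (⊛-identityˡ f))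
        }
      ; comm = ⊛-comm
      }
    ; distribʳ = λ h f g → mk≋ λ n → ≡.trans (⊛≗⊗ (f ⊕ g) h n)
        (≡.trans (⊗-distribʳ-⊕ f g h n) (≡.sym (cong₂ _+_ (⊛≗⊗ f h n) (⊛≗⊗ g h n))))
    ; zeroˡ = λ f → ≋-trans (const-⊛ 0ℚ f) (mk≋ λ n → ≡.trans (ℚ.*-zeroˡ (f n)) (≡.sym (const0 n)))
    }
  ; -‿cong = λ p → mk≋ λ n → cong -_ (coeff≡ p n)
  ; -‿*-distribˡ = λ f g → mk≋ λ n →
      ≡.trans (⊛≗⊗ (-ₛ f) g n) (≡.trans (⊗-negˡ f g n) (cong -_ (≡.sym (⊛≗⊗ f g n))))
  ; -‿+-comm = λ f g → mk≋ λ n → ≡.sym (ℚ.neg-distrib-+ (f n) (g n))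
  }
  where
  open Setoid ≋-setoid using (isEquivalence)
  const0 : ∀ n → 0ₛ n ≡ 0ℚ
  const0 zero    = refl
  const0 (suc n) = refl
  ⊛-identityˡ : ∀ f → 1ₛ ⊛ f ≋ f
  ⊛-identityˡ f = ≋-trans (const-⊛ 1ℚ f) (mk≋ λ n → ℚ.*-identityˡ (f n))

seriesRing : AlmostCommutativeRing 0ℓ 0ℓ
seriesRing = record
  { Carrier = Series ; _≈_ = _≋_ ; _+_ = _⊕_ ; _*_ = _⊛_ ; -_ = -ₛ_ ; 0# = 0ₛ ; 1# = 1ₛ
  ; isAlmostCommutativeRing = isAlmostCommutativeRing
  }

const-+ : ∀ x y → const (x + y) ≋ const x ⊕ const y
const-+ x y = mk≋ λ { zero → refl ; (suc n) → ℚ.+-identityʳ 0ℚ }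

const-* : ∀ x y → const (x * y) ≋ const x ⊛ const y
const-* x y = ≋-sym (≋-trans (const-⊛ x (const y)) (mk≋ λ { zero → refl ; (suc n) → ℚ.*-zeroʳ x }))

const-homomorphism : ℚ.+-*-rawRing -Raw-AlmostCommutative⟶ seriesRing
const-homomorphism = record
  { ⟦_⟧    = const
  ; +-homo = const-+
  ; *-homo = const-*
  ; -‿homo = λ x → mk≋ λ { zero → refl ; (suc n) → refl }
  ; 0-homo = ≋-refl
  ; 1-homo = ≋-refl
  }

const≟ : WeaklyDecidable (λ x y → const x ≋ const y)
const≟ x y with x ℚ.≟ y
... | yes x≡y = just (const-cong x≡y)
... | no  _   = nothing

module SeriesSolver = Algebra.Solver.Ring ℚ.+-*-rawRing seriesRing const-homomorphism const≟

⊕-congˡ : ∀ f {g g′} → g ≋ g′ → f ⊕ g ≋ f ⊕ g′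
⊕-congˡ f p = ⊕-cong {f} {f} ≋-refl p

⊕-congʳ : ∀ {f f′} g → f ≋ f′ → f ⊕ g ≋ f′ ⊕ g
⊕-congʳ {f} {f′} g p = ⊕-cong {f} {f′} {g} {g} p ≋-refl

⊛-congˡ : ∀ f {g g′} → g ≋ g′ → f ⊛ g ≋ f ⊛ g′
⊛-congˡ f p = ⊛-cong {f} {f} ≋-refl p

⊛-congʳ : ∀ {f f′} g → f ≋ f′ → f ⊛ g ≋ f′ ⊛ g
⊛-congʳ {f} {f′} g p = ⊛-cong {f} {f′} {g} {g} p ≋-refl

z⊛-zero : ∀ f → (zS ⊛ f) 0 ≡ 0ℚ
z⊛-zero f = ℚ.*-zeroˡ (f 0)

z⊛-suc : ∀ f n → (zS ⊛ f) (suc n) ≡ f n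
z⊛-suc f n = begin
  (zS ⊛ f) (suc n)              ≡⟨ ⊛≗⊗ zS f (suc n) ⟩
  0ℚ * f (suc n) + (tail zS ⊗ f) n ≡⟨ cong₂ _+_ (ℚ.*-zeroˡ (f (suc n))) (⊗-cong tail-zS ≋-refl n) ⟩
  0ℚ + (1ₛ ⊗ f) n               ≡⟨ ℚ.+-identityˡ _ ⟩
  (1ₛ ⊗ f) n                    ≡⟨ const-⊗ 1ℚ f n ⟩
  1ℚ * f n                      ≡⟨ ℚ.*-identityˡ (f n) ⟩
  f n                           ∎
  where
  open ≡.≡-Reasoning
  tail-zS : tail zS ≋ 1ₛ
  tail-zS = mk≋ λ { zero → refl ; (suc n) → refl }

*-cancelˡ-≢0 : ∀ {c x y} → c ≢ 0ℚ → c * x ≡ c * y → x ≡ y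
*-cancelˡ-≢0 {c} {x} {y} c≢0 cx≡cy = begin
  x                ≡⟨ ≡.sym (cancel x) ⟩
  1/ c * (c * x)   ≡⟨ cong (1/ c *_) cx≡cy ⟩
  1/ c * (c * y)   ≡⟨ cancel y ⟩
  y                ∎
  where
  open ≡.≡-Reasoning
  instance _ = ℚ.≢-nonZero c≢0
  cancel : ∀ z → 1/ c * (c * z) ≡ z
  cancel z = ≡.trans (≡.sym (ℚ.*-assoc (1/ c) c z)) (≡.trans (cong (_* z) (ℚ.*-inverseˡ c)) (ℚ.*-identityˡ z))

⊗-congʳ-upTo : ∀ f {g h} n → (∀ m → m ≤ n → g m ≡ h m) → (f ⊗ g) n ≡ (f ⊗ h) n
⊗-congʳ-upTo f zero    g≡h = cong (f 0 *_) (g≡h 0 z≤n)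
⊗-congʳ-upTo f (suc n) g≡h = cong₂ _+_ (cong (f 0 *_) (g≡h (suc n) ℕ.≤-refl))
  (⊗-congʳ-upTo (tail f) n λ m m≤n → g≡h m (ℕ.m≤n⇒m≤1+n m≤n))

⊛-cancelˡ : ∀ f {g h} → f 0 ≢ 0ℚ → f ⊛ g ≋ f ⊛ h → g ≋ h
⊛-cancelˡ f {g} {h} f0≢0 fg≋fh = mk≋ (<-rec (λ n → g n ≡ h n) agree)
  where
  fg≡fh : ∀ n → (f ⊗ g) n ≡ (f ⊗ h) n
  fg≡fh n = ≡.trans (≡.sym (⊛≗⊗ f g n)) (≡.trans (coeff≡ fg≋fh n) (⊛≗⊗ f h n))
  agree : ∀ n → (∀ {m} → m ℕ.< n → g m ≡ h m) → g n ≡ h n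
  agree zero    _  = *-cancelˡ-≢0 f0≢0 (fg≡fh 0)
  agree (suc n) ih = *-cancelˡ-≢0 f0≢0 (∙-cancelʳ ((tail f ⊗ h) n) _ _
    (≡.trans (cong (f 0 * g (suc n) +_) (≡.sym (⊗-congʳ-upTo (tail f) n λ m m≤n → ih (s≤s m≤n))))
             (fg≡fh (suc n))))

-- Expectations under the chain

mean : (State → ℚ) → List (State × ℚ) → ℚ
mean g []            = 0ℚ
mean g ((s , p) ∷ μ) = g s * p + mean g μ

mean-cong : ∀ {g h} → (∀ s → g s ≡ h s) → ∀ μ → mean g μ ≡ mean h μ
mean-cong g≡h []            = refl
mean-cong g≡h ((s , p) ∷ μ) = cong₂ _+_ (cong (_* p) (g≡h s)) (mean-cong g≡h μ)

mean-++ : ∀ g μ ν → mean g (μ ++ ν) ≡ mean g μ + mean g ν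
mean-++ g []            ν = ≡.sym (ℚ.+-identityˡ _)
mean-++ g ((s , p) ∷ μ) ν = ≡.trans (cong (g s * p +_) (mean-++ g μ ν)) (≡.sym (ℚ.+-assoc (g s * p) _ _))

mean-linear : ∀ c g h μ → mean (λ s → c * g s + h s) μ ≡ c * mean g μ + mean h μ
mean-linear c g h []            = ≡.sym (≡.trans (cong (_+ 0ℚ) (ℚ.*-zeroʳ c)) (ℚ.+-identityˡ 0ℚ))
mean-linear c g h ((s , p) ∷ μ) = ≡.trans (cong ((c * g s + h s) * p +_) (mean-linear c g h μ))
  (solve 6 (λ c x y p u w → (c :* x :+ y) :* p :+ (c :* u :+ w) := c :* (x :* p :+ u) :+ (y :* p :+ w)) refl
     c (g s) (h s) p (mean g μ) (mean h μ))
  where open +-*-Solver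

mean-scale : ∀ c g μ → mean (λ s → c * g s) μ ≡ c * mean g μ
mean-scale c g []            = ≡.sym (ℚ.*-zeroʳ c)
mean-scale c g ((s , p) ∷ μ) = ≡.trans (cong (c * g s * p +_) (mean-scale c g μ))
  (solve 4 (λ c x p u → c :* x :* p :+ c :* u := c :* (x :* p :+ u)) refl c (g s) p (mean g μ))
  where open +-*-Solver

-- The pattern-matching lambdas in the definition of law can only be referred to through their behaviour.
mean-map-scale : ∀ g c (F : State × ℚ → State × ℚ) → (∀ t q → F (t , q) ≡ (t , c * q)) →
                 ∀ μ → mean g (map F μ) ≡ mean g μ * c
mean-map-scale g c F F-scales []            = ≡.sym (ℚ.*-zeroˡ c)
mean-map-scale g c F F-scales ((t , q) ∷ μ) rewrite F-scales t q =
  ≡.trans (cong (g t * (c * q) +_) (mean-map-scale g c F F-scales μ))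
    (solve 4 (λ x c q u → x :* (c :* q) :+ u :* c := (x :* q :+ u) :* c) refl (g t) c q (mean g μ))
  where open +-*-Solver

mean-concatMap : ∀ g h (F : State × ℚ → List (State × ℚ)) → (∀ s p → mean g (F (s , p)) ≡ h s * p) →
                 ∀ μ → mean g (concatMap F μ) ≡ mean h μ
mean-concatMap g h F F-mean []            = refl
mean-concatMap g h F F-mean ((s , p) ∷ μ) =
  ≡.trans (mean-++ g (F (s , p)) (concatMap F μ)) (cong₂ _+_ (F-mean s p) (mean-concatMap g h F F-mean μ))

sumℚ-map≡mean : ∀ g (F : State × ℚ → ℚ) → (∀ s p → F (s , p) ≡ g s * p) → ∀ μ → sumℚ (map F μ) ≡ mean g μ
sumℚ-map≡mean g F F≡ []            = refl
sumℚ-map≡mean g F F≡ ((s , p) ∷ μ) = cong₂ _+_ (F≡ s p) (sumℚ-map≡mean g F F≡ μ)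

double : ℕ → ℕ
double zero    = zero
double (suc k) = suc (suc (double k))

isEven-double : ∀ k → isEven (double k) ≡ true
isEven-double zero    = refl
isEven-double (suc k) = isEven-double k

isEven-suc-double : ∀ k → isEven (suc (double k)) ≡ false
isEven-suc-double zero    = refl
isEven-suc-double (suc k) = isEven-suc-double k

data EvenState : Set where
  u l : ℕ → EvenState
  q   : EvenState

toState : EvenState → State
toState (u k) = U (double k)
toState (l k) = L (suc (double k))
toState q     = Q

evenWeight : EvenState → ℚ
evenWeight (u k) = ℕ→ℚ (double k)
evenWeight (l k) = ℕ→ℚ (suc (double k))
evenWeight q     = 0ℚ

weight-toState : ∀ e → weight (toState e) ≡ evenWeight e
weight-toState (u k) rewrite isEven-double k     = refl
weight-toState (l k) rewrite isEven-suc-double k = refl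
weight-toState q     = refl

module TransitionOperator (α β : ℚ) where

  open +-*-Solver

  T : (State → ℚ) → State → ℚ
  T g s = mean g (step α β s)

  T^ : ℕ → (State → ℚ) → State → ℚ
  T^ zero    g = g
  T^ (suc n) g = T^ n (T g)

  T^-suc : ∀ n g s → T^ (suc n) g s ≡ T (T^ n g) s
  T^-suc zero    g s = refl
  T^-suc (suc n) g s = T^-suc n (T g) s

  mean-law : ∀ n g → mean g (law α β n) ≡ T^ n g (U 0)
  mean-law zero    g = ≡.trans (cong (_+ 0ℚ) (ℚ.*-identityʳ (g (U 0)))) (ℚ.+-identityʳ (g (U 0)))
  mean-law (suc n) g = ≡.trans
    (mean-concatMap g (T g) _ (λ s p → mean-map-scale g p _ (λ t q → refl) (step α β s)) (law α β n))
    (mean-law n (T g))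

  expectedWeight≡T^ : ∀ n → expectedWeight α β n ≡ T^ n weight (U 0)
  expectedWeight≡T^ n = ≡.trans (sumℚ-map≡mean weight _ (λ s p → refl) (law α β n)) (mean-law n weight)

  T²-linear : ∀ c g h s → T (T (λ t → c * g t + h t)) s ≡ c * T (T g) s + T (T h) s
  T²-linear c g h s = ≡.trans (mean-cong (λ t → mean-linear c g h (step α β t)) (step α β s))
                              (mean-linear c (T g) (T h) (step α β s))

  T²-scale : ∀ c g s → T (T (λ t → c * g t)) s ≡ c * T (T g) s
  T²-scale c g s = ≡.trans (mean-cong (λ t → mean-scale c g (step α β t)) (step α β s))
                           (mean-scale c (T g) (step α β s))

  balanced : ℚ → ℚ → ℚ → ℚ
  balanced x y z = α * β * x + (α * α + β * β) * y + α * β * z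

  T₂ : EvenState → (EvenState → ℚ) → ℚ
  T₂ (u zero)    g = balanced (g (u 1)) (g (u 0)) (g (l 0))
  T₂ (u (suc k)) g = balanced (g (u (suc (suc k)))) (g (u (suc k))) (g (u k))
  T₂ (l zero)    g = balanced (g (l 1)) (g (l 0)) (g q)
  T₂ (l (suc k)) g = balanced (g (l (suc (suc k)))) (g (l (suc k))) (g (l k))
  T₂ q           g = α * β * g (l 0) + α * α * g q + β * β * g (u 1) + α * β * g (u 0)

  T₂-cong : ∀ e {g h} → (∀ e′ → g e′ ≡ h e′) → T₂ e g ≡ T₂ e h
  T₂-cong (u zero)    g≡h rewrite g≡h (u 1) | g≡h (u 0) | g≡h (l 0) = refl
  T₂-cong (u (suc k)) g≡h rewrite g≡h (u (suc (suc k))) | g≡h (u (suc k)) | g≡h (u k) = refl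
  T₂-cong (l zero)    g≡h rewrite g≡h (l 1) | g≡h (l 0) | g≡h q = refl
  T₂-cong (l (suc k)) g≡h rewrite g≡h (l (suc (suc k))) | g≡h (l (suc k)) | g≡h (l k) = refl
  T₂-cong q           g≡h rewrite g≡h (l 0) | g≡h q | g≡h (u 1) | g≡h (u 0) = refl

  private
    two-steps : ∀ x y z → (x * β + (y * α + 0ℚ)) * α + ((y * β + (z * α + 0ℚ)) * β + 0ℚ)
                          ≡ balanced x y z
    two-steps x y z = solve 5 (λ a b x y z →
      (x :* b :+ (y :* a :+ con 0ℚ)) :* a :+ ((y :* b :+ (z :* a :+ con 0ℚ)) :* b :+ con 0ℚ)
      := a :* b :* x :+ (a :* a :+ b :* b) :* y :+ a :* b :* z) refl α β x y z

  T²-toState : ∀ h e → T (T h) (toState e) ≡ T₂ e (h ∘ toState)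
  T²-toState h (u zero)    = two-steps (h (U 2)) (h (U 0)) (h (L 1))
  T²-toState h (u (suc k)) rewrite isEven-double k | isEven-suc-double k =
    two-steps (h (U (double (suc (suc k))))) (h (U (double (suc k)))) (h (U (double k)))
  T²-toState h (l zero)    = two-steps (h (L 3)) (h (L 1)) (h Q)
  T²-toState h (l (suc k)) rewrite isEven-suc-double k | isEven-double k =
    two-steps (h (L (suc (double (suc (suc k)))))) (h (L (suc (double (suc k))))) (h (L (suc (double k))))
  T²-toState h q = solve 6 (λ a b x y z w →
      (x :* b :+ (y :* a :+ con 0ℚ)) :* a :+ ((z :* b :+ (w :* a :+ con 0ℚ)) :* b :+ con 0ℚ)
      := a :* b :* x :+ a :* a :* y :+ b :* b :* z :+ a :* b :* w) refl α β (h (L 1)) (h Q) (h (U 2)) (h (U 0))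

-- Generating functions along the even states

module EvenGeneratingFunctions (α β : ℚ) where

  open TransitionOperator α β

  K : ℕ → State → ℚ
  K m = T^ (m ℕ.+ m) weight

  K-suc : ∀ m s → K (suc m) s ≡ T (T (K m)) s
  K-suc m s rewrite ℕ.+-suc m m =
    ≡.trans (T^-suc (m ℕ.+ m) (T weight) s) (mean-cong (λ t → T^-suc (m ℕ.+ m) weight t) (step α β s))

  ⊗-T² : ∀ f (G : ℕ → State → ℚ) s n → (f ⊗ (λ m → T (T (G m)) s)) n ≡ T (T (λ t → (f ⊗ λ m → G m t) n)) s
  ⊗-T² f G s zero    = ≡.sym (T²-scale (f 0) (G 0) s)
  ⊗-T² f G s (suc n) = ≡.trans (cong (f 0 * T (T (G (suc n))) s +_) (⊗-T² (tail f) G s n))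
    (≡.sym (T²-linear (f 0) (G (suc n)) (λ t → (tail f ⊗ λ m → G m t) n) s))

  T₂ˢ : EvenState → (EvenState → Series) → Series
  T₂ˢ e Y m = T₂ e (λ e′ → Y e′ m)

  ⊛-K-unique : ∀ D (Y : EvenState → Series) →
               (∀ e → Y e ≋ const (evenWeight e) ⊛ D ⊕ zS ⊛ T₂ˢ e Y) →
               ∀ e → D ⊛ (λ m → K m (toState e)) ≋ Y e
  ⊛-K-unique D Y Y-rec e = mk≋ λ n → ≡.trans (⊛≗⊗ D _ n) (coeff-agree n e)
    where
    open ≡.≡-Reasoning
    Y-rec′ : ∀ e n → Y e n ≡ evenWeight e * D n + (zS ⊛ T₂ˢ e Y) n
    Y-rec′ e n = ≡.trans (coeff≡ (Y-rec e) n) (cong (_+ (zS ⊛ T₂ˢ e Y) n) (coeff≡ (const-⊛ (evenWeight e) D) n))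
    coeff-agree : ∀ n e → (D ⊗ (λ m → K m (toState e))) n ≡ Y e n
    coeff-agree zero e = ≡.sym (begin
      Y e 0                                         ≡⟨ Y-rec′ e 0 ⟩
      evenWeight e * D 0 + (zS ⊛ T₂ˢ e Y) 0         ≡⟨ cong (evenWeight e * D 0 +_) (z⊛-zero (T₂ˢ e Y)) ⟩
      evenWeight e * D 0 + 0ℚ                       ≡⟨ ℚ.+-identityʳ _ ⟩
      evenWeight e * D 0                            ≡⟨ ℚ.*-comm (evenWeight e) (D 0) ⟩
      D 0 * evenWeight e                            ≡⟨ cong (D 0 *_) (≡.sym (weight-toState e)) ⟩
      D 0 * weight (toState e)                      ∎)
    coeff-agree (suc n) e = begin
      (D ⊗ (λ m → K m (toState e))) (suc n)
        ≡⟨ ⊗-sucʳ D _ n ⟩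
      (D ⊗ (λ m → K (suc m) (toState e))) n + D (suc n) * weight (toState e)
        ≡⟨ cong₂ _+_ (⊗-cong ≋-refl (mk≋ λ m → K-suc m (toState e)) n)
                     (≡.trans (ℚ.*-comm (D (suc n)) _) (cong (_* D (suc n)) (weight-toState e))) ⟩
      (D ⊗ (λ m → T (T (K m)) (toState e))) n + evenWeight e * D (suc n)
        ≡⟨ cong (_+ evenWeight e * D (suc n)) (⊗-T² D K (toState e) n) ⟩
      T (T (λ t → (D ⊗ λ m → K m t) n)) (toState e) + evenWeight e * D (suc n)
        ≡⟨ cong (_+ evenWeight e * D (suc n)) (T²-toState _ e) ⟩
      T₂ e (λ e′ → (D ⊗ λ m → K m (toState e′)) n) + evenWeight e * D (suc n)
        ≡⟨ cong (_+ evenWeight e * D (suc n)) (T₂-cong e (λ e′ → coeff-agree n e′)) ⟩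
      T₂ˢ e Y n + evenWeight e * D (suc n)
        ≡⟨ ℚ.+-comm (T₂ˢ e Y n) _ ⟩
      evenWeight e * D (suc n) + T₂ˢ e Y n
        ≡⟨ cong (evenWeight e * D (suc n) +_) (≡.sym (z⊛-suc (T₂ˢ e Y) n)) ⟩
      evenWeight e * D (suc n) + (zS ⊛ T₂ˢ e Y) (suc n)
        ≡⟨ ≡.sym (Y-rec′ e (suc n)) ⟩
      Y e (suc n) ∎

-- The closed form

ℕ→ℚ-+ : ∀ i j → ℕ→ℚ (i ℕ.+ j) ≡ ℕ→ℚ i + ℕ→ℚ j
ℕ→ℚ-+ i j = ≡.sym (≡.trans (cong₂ _+_ (ℕ→ℚ≡mkℚ i) (ℕ→ℚ≡mkℚ j))
  (cong (_/ 1) (cong₂ ℤ._+_ (ℤ.*-identityʳ (ℤ.+ i)) (ℤ.*-identityʳ (ℤ.+ j)))))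
  where
  ℕ→ℚ≡mkℚ : ∀ m → ℕ→ℚ m ≡ mkℚ (ℤ.+ m) 0 (Coprime.sym (Coprime.1-coprimeTo m))
  ℕ→ℚ≡mkℚ m = ℚ.normalize-coprime (Coprime.sym (Coprime.1-coprimeTo m))

const-ℕ→ℚ-+ : ∀ i j → const (ℕ→ℚ (i ℕ.+ j)) ≋ const (ℕ→ℚ i) ⊕ const (ℕ→ℚ j)
const-ℕ→ℚ-+ i j = ≋-trans (const-cong (ℕ→ℚ-+ i j)) (const-+ _ _)

-- Polynomials in a (standing for α) and v; D and N are the denominator and numerator of the theorem.
module Shapes {m} (a v : SeriesSolver.Polynomial m) where

  open SeriesSolver using (Polynomial; con; _:+_; _:*_; _:-_)

  ι : ℕ → Polynomial m
  ι k = con (ℕ→ℚ k)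

  one b pq ab S D C F N Aˡ G : Polynomial m
  one = con 1ℚ
  b   = one :- a
  pq  = (a :+ b :* v) :* (b :+ a :* v)
  ab  = a :* b
  S   = a :* a :+ b :* b
  D   = a :* b :* ((one :- v) :* (one :- v) :* (one :- v)) :* (one :+ v :+ v :* v)
  C   = pq :* (one :- v :* v :* v)
  F   = ι 3 :* b :* (v :* v) :+ ι 3 :* a :+ ι 3 :* b :* v :+ a :* v :+ a :* (v :* v) :+ a :* (v :* v :* v)
  N   = v :* (a :* v :+ b) :* F
  Aˡ  = (a :* v :+ b) :* F :- ι 3 :* C
  G   = v :* (ι 2 :- ι 3 :* a :+ a :* a) :+ v :* v :* (ι 6 :* a :- ι 5 :* a :* a)
        :+ v :* v :* v :* (ι 3 :- ι 5 :* a :+ ι 6 :* a :* a)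
        :+ v :* v :* v :* v :* (one :+ a :- a :* a) :+ v :* v :* v :* v :* v :* (a :- a :* a)

module ClosedForm (α : ℚ) (αβ≢0 : α * (1ℚ - α) ≢ 0ℚ) (v : Series) (v0 : v 0 ≡ 0ℚ)
  (v-eq : zS ⊛ ((const α ⊕ (1ℚ - α) · v) ⊛ (const (1ℚ - α) ⊕ α · v)) ≋ v) where

  β : ℚ
  β = 1ℚ - α

  open SeriesSolver using (Polynomial; ⟦_⟧; solve; var; _:+_; _:*_; _:=_)

  open TransitionOperator α β
  open EvenGeneratingFunctions α β
  open SetoidReasoning ≋-setoid

  ⟪_⟫ : Polynomial 2 → Series
  ⟪ p ⟫ = ⟦ p ⟧ (const α ∷ v ∷ [])

  module P = Shapes {2} (var zero) (var (suc zero))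

  _^_ : Series → ℕ → Series
  f ^ zero  = 1ₛ
  f ^ suc k = f ⊛ f ^ k

  ray : Series → ℕ → Series → Series
  ray amp j w = const (ℕ→ℚ j) ⊛ ⟪ P.C ⟫ ⊕ amp ⊛ w

  -- Away from the boundary the two-step recursion is solved by j·C + A·vᵏ: the powers of v solve its
  -- homogeneous part because z·(αβv² + (α² + β²)v + αβ) = z·(α + βv)(β + αv) = v, and C = D/(1 − z).
  -- The amplitudes N on the u-ray and Aˡ on the l-ray, and the value G at q, are fixed by the boundary.
  Y : EvenState → Series
  Y (u k) = ray ⟪ P.N ⟫ (double k) (v ^ k)
  Y (l k) = ray ⟪ P.Aˡ ⟫ (suc (double k)) (v ^ k)
  Y q     = ⟪ P.G ⟫

  scale-≋ : ∀ {c K} → const c ≋ K → ∀ X → c · X ≋ K ⊛ X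
  scale-≋ {c} c≋K X = ≋-trans (≋-sym (const-⊛ c X)) (⊛-congʳ X c≋K)

  β≋ : const β ≋ ⟪ P.b ⟫
  β≋ = mk≋ λ { zero → refl ; (suc n) → refl }

  αβ≋ : const (α * β) ≋ ⟪ P.ab ⟫
  αβ≋ = ≋-trans (const-* α β) (⊛-congˡ (const α) β≋)

  α²≋ : const (α * α) ≋ ⟪ var zero :* var zero ⟫
  α²≋ = const-* α α

  β²≋ : const (β * β) ≋ ⟪ P.b :* P.b ⟫
  β²≋ = ≋-trans (const-* β β) (⊛-cong β≋ β≋)

  balancedˢ : Series → Series → Series → Series
  balancedˢ X Y Z n = balanced (X n) (Y n) (Z n)

  balancedˢ-≋ : ∀ X Y Z → balancedˢ X Y Z ≋ ⟪ P.ab ⟫ ⊛ X ⊕ ⟪ P.S ⟫ ⊛ Y ⊕ ⟪ P.ab ⟫ ⊛ Z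
  balancedˢ-≋ X Y Z = ⊕-cong (⊕-cong (scale-≋ αβ≋ X) (scale-≋ S≋ Y)) (scale-≋ αβ≋ Z)
    where
    S≋ : const (α * α + β * β) ≋ ⟪ P.S ⟫
    S≋ = ≋-trans (const-+ (α * α) (β * β)) (⊕-cong α²≋ β²≋)

  T₂ˢ-q-≋ : T₂ˢ q Y ≋ ⟪ P.ab ⟫ ⊛ Y (l 0) ⊕ ⟪ var zero :* var zero ⟫ ⊛ Y q
                       ⊕ ⟪ P.b :* P.b ⟫ ⊛ Y (u 1) ⊕ ⟪ P.ab ⟫ ⊛ Y (u 0)
  T₂ˢ-q-≋ = ⊕-cong (⊕-cong (⊕-cong (scale-≋ αβ≋ (Y (l 0))) (scale-≋ α²≋ (Y q))) (scale-≋ β²≋ (Y (u 1))))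
                   (scale-≋ αβ≋ (Y (u 0)))

  pq₀ : ⟪ P.pq ⟫ 0 ≡ α * β
  pq₀ rewrite v0 = cong₂ _*_ (≡.trans (cong (α +_) (ℚ.*-zeroʳ β)) (ℚ.+-identityʳ α))
                             (≡.trans (cong (β +_) (ℚ.*-zeroʳ α)) (ℚ.+-identityʳ β))

  v≋pq⊛z : v ≋ ⟪ P.pq ⟫ ⊛ zS
  v≋pq⊛z = ≋-trans (≋-sym v-eq) (≋-trans (⊛-congˡ zS pq≋) (⊛-comm zS ⟪ P.pq ⟫))
    where
    pq≋ : (const α ⊕ β · v) ⊛ (const β ⊕ α · v) ≋ ⟪ P.pq ⟫
    pq≋ = ⊛-cong (⊕-congˡ (const α) (scale-≋ β≋ v)) (⊕-cong β≋ (≋-sym (const-⊛ α v)))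

  -- v = z·(α + βv)(β + αv), and the factor (α + βv)(β + αv) has constant term αβ ≠ 0, so it cancels.
  from-v-form : ∀ W R {X} → ⟪ P.pq ⟫ ⊛ X ≋ ⟪ P.pq ⟫ ⊛ W ⊕ v ⊛ R → X ≋ W ⊕ zS ⊛ R
  from-v-form W R {X} eq = ⊛-cancelˡ ⟪ P.pq ⟫ (λ pq₀≡0 → αβ≢0 (≡.trans (≡.sym pq₀) pq₀≡0)) (begin
    ⟪ P.pq ⟫ ⊛ X                          ≈⟨ eq ⟩
    ⟪ P.pq ⟫ ⊛ W ⊕ v ⊛ R                  ≈⟨ ⊕-congˡ (⟪ P.pq ⟫ ⊛ W) (⊛-congʳ R v≋pq⊛z) ⟩
    ⟪ P.pq ⟫ ⊛ W ⊕ ⟪ P.pq ⟫ ⊛ zS ⊛ R      ≈⟨ solve 4 (λ p w z r → p :* w :+ p :* z :* r := p :* (w :+ z :* r)) ≋-refl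
                                                ⟪ P.pq ⟫ W zS R ⟩
    ⟪ P.pq ⟫ ⊛ (W ⊕ zS ⊛ R)               ∎)

  ray-recursion : ∀ amp j k →
    ray amp (2 ℕ.+ j) (v ^ suc k)
      ≋ const (ℕ→ℚ (2 ℕ.+ j)) ⊛ ⟪ P.D ⟫
        ⊕ zS ⊛ balancedˢ (ray amp (4 ℕ.+ j) (v ^ suc (suc k))) (ray amp (2 ℕ.+ j) (v ^ suc k)) (ray amp j (v ^ k))
  ray-recursion amp j k = from-v-form (const (ℕ→ℚ (2 ℕ.+ j)) ⊛ ⟪ P.D ⟫) (balancedˢ X₄ X₂ X₀) (begin
    ⟪ P.pq ⟫ ⊛ X₂
      ≈⟨ ⊛-congˡ ⟪ P.pq ⟫ X₂≋ ⟩
    ⟪ P.pq ⟫ ⊛ ((c₂ ⊕ d) ⊛ ⟪ P.C ⟫ ⊕ amp ⊛ (v ⊛ w))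
      ≈⟨ solve 5 (λ a v w d A → let open Shapes a v in
           pq :* ((ι 2 :+ d) :* C :+ A :* (v :* w))
           := pq :* ((ι 2 :+ d) :* D)
              :+ v :* (ab :* ((ι 2 :+ (ι 2 :+ d)) :* C :+ A :* (v :* (v :* w)))
                       :+ S :* ((ι 2 :+ d) :* C :+ A :* (v :* w)) :+ ab :* (d :* C :+ A :* w)))
           ≋-refl (const α) v w d amp ⟩
    ⟪ P.pq ⟫ ⊛ ((c₂ ⊕ d) ⊛ ⟪ P.D ⟫)
      ⊕ v ⊛ (⟪ P.ab ⟫ ⊛ ((c₂ ⊕ (c₂ ⊕ d)) ⊛ ⟪ P.C ⟫ ⊕ amp ⊛ (v ⊛ (v ⊛ w)))
             ⊕ ⟪ P.S ⟫ ⊛ ((c₂ ⊕ d) ⊛ ⟪ P.C ⟫ ⊕ amp ⊛ (v ⊛ w)) ⊕ ⟪ P.ab ⟫ ⊛ X₀)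
      ≈⟨ ⊕-cong (⊛-congˡ ⟪ P.pq ⟫ (⊛-congʳ ⟪ P.D ⟫ (≋-sym w₂)))
                (⊛-congˡ v (≋-sym (≋-trans (balancedˢ-≋ X₄ X₂ X₀)
                  (⊕-congʳ (⟪ P.ab ⟫ ⊛ X₀) (⊕-cong (⊛-congˡ ⟪ P.ab ⟫ X₄≋) (⊛-congˡ ⟪ P.S ⟫ X₂≋)))))) ⟩
    ⟪ P.pq ⟫ ⊛ (const (ℕ→ℚ (2 ℕ.+ j)) ⊛ ⟪ P.D ⟫) ⊕ v ⊛ balancedˢ X₄ X₂ X₀ ∎)
    where
    w d c₂ X₀ X₂ X₄ : Series
    w  = v ^ k
    d  = const (ℕ→ℚ j)
    c₂ = const (ℕ→ℚ 2)
    X₀ = ray amp j w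
    X₂ = ray amp (2 ℕ.+ j) (v ⊛ w)
    X₄ = ray amp (4 ℕ.+ j) (v ⊛ (v ⊛ w))
    w₂ : const (ℕ→ℚ (2 ℕ.+ j)) ≋ c₂ ⊕ d
    w₂ = const-ℕ→ℚ-+ 2 j
    X₂≋ : X₂ ≋ (c₂ ⊕ d) ⊛ ⟪ P.C ⟫ ⊕ amp ⊛ (v ⊛ w)
    X₂≋ = ⊕-congʳ (amp ⊛ (v ⊛ w)) (⊛-congʳ ⟪ P.C ⟫ w₂)
    X₄≋ : X₄ ≋ (c₂ ⊕ (c₂ ⊕ d)) ⊛ ⟪ P.C ⟫ ⊕ amp ⊛ (v ⊛ (v ⊛ w))
    X₄≋ = ⊕-congʳ (amp ⊛ (v ⊛ (v ⊛ w))) (⊛-congʳ ⟪ P.C ⟫ (≋-trans (const-ℕ→ℚ-+ 2 (2 ℕ.+ j)) (⊕-congˡ c₂ w₂)))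

  Y-recursion : ∀ e → Y e ≋ const (evenWeight e) ⊛ ⟪ P.D ⟫ ⊕ zS ⊛ T₂ˢ e Y
  Y-recursion (u zero) = from-v-form (const 0ℚ ⊛ ⟪ P.D ⟫) (T₂ˢ (u 0) Y) (≋-trans
    (solve 2 (λ a v → let open Shapes a v in
       pq :* (ι 0 :* C :+ N :* one)
       := pq :* (ι 0 :* D) :+ v :* (ab :* (ι 2 :* C :+ N :* (v :* one)) :+ S :* (ι 0 :* C :+ N :* one)
                                    :+ ab :* (ι 1 :* C :+ Aˡ :* one)))
       ≋-refl (const α) v)
    (⊕-congˡ (⟪ P.pq ⟫ ⊛ (const 0ℚ ⊛ ⟪ P.D ⟫)) (⊛-congˡ v (≋-sym (balancedˢ-≋ (Y (u 1)) (Y (u 0)) (Y (l 0)))))))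
  Y-recursion (l zero) = from-v-form (const 1ℚ ⊛ ⟪ P.D ⟫) (T₂ˢ (l 0) Y) (≋-trans
    (solve 2 (λ a v → let open Shapes a v in
       pq :* (ι 1 :* C :+ Aˡ :* one)
       := pq :* (ι 1 :* D) :+ v :* (ab :* (ι 3 :* C :+ Aˡ :* (v :* one)) :+ S :* (ι 1 :* C :+ Aˡ :* one)
                                    :+ ab :* G))
       ≋-refl (const α) v)
    (⊕-congˡ (⟪ P.pq ⟫ ⊛ (const 1ℚ ⊛ ⟪ P.D ⟫)) (⊛-congˡ v (≋-sym (balancedˢ-≋ (Y (l 1)) (Y (l 0)) (Y q))))))
  Y-recursion q = from-v-form (const 0ℚ ⊛ ⟪ P.D ⟫) (T₂ˢ q Y) (≋-trans
    (solve 2 (λ a v → let open Shapes a v in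
       pq :* G
       := pq :* (ι 0 :* D) :+ v :* (ab :* (ι 1 :* C :+ Aˡ :* one) :+ a :* a :* G
                                    :+ b :* b :* (ι 2 :* C :+ N :* (v :* one)) :+ ab :* (ι 0 :* C :+ N :* one)))
       ≋-refl (const α) v)
    (⊕-congˡ (⟪ P.pq ⟫ ⊛ (const 0ℚ ⊛ ⟪ P.D ⟫)) (⊛-congˡ v (≋-sym T₂ˢ-q-≋))))
  Y-recursion (u (suc k)) = ray-recursion ⟪ P.N ⟫ (double k) k
  Y-recursion (l (suc k)) = ray-recursion ⟪ P.Aˡ ⟫ (suc (double k)) k

  E⊛D≋N : E α ⊛ ⟪ P.D ⟫ ≋ ⟪ P.N ⟫
  E⊛D≋N = begin
    E α ⊛ ⟪ P.D ⟫                        ≈⟨ ⊛-comm (E α) ⟪ P.D ⟫ ⟩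
    ⟪ P.D ⟫ ⊛ E α                        ≈⟨ ⊛-congˡ ⟪ P.D ⟫ (mk≋ λ m → expectedWeight≡T^ (m ℕ.+ m)) ⟩
    ⟪ P.D ⟫ ⊛ (λ m → K m (toState (u 0))) ≈⟨ ⊛-K-unique ⟪ P.D ⟫ Y Y-recursion (u 0) ⟩
    Y (u 0)                              ≈⟨ solve 2 (λ a v → let open Shapes a v in ι 0 :* C :+ N :* one := N)
                                                  ≋-refl (const α) v ⟩
    ⟪ P.N ⟫                              ∎

  D≋ : (α * β) · ((const 1ℚ ⊖ v) ⊛ (const 1ℚ ⊖ v) ⊛ (const 1ℚ ⊖ v)) ⊛ (const 1ℚ ⊕ v ⊕ v ⊛ v) ≋ ⟪ P.D ⟫
  D≋ = ⊛-congʳ (const 1ℚ ⊕ v ⊕ v ⊛ v) (scale-≋ αβ≋ ((const 1ℚ ⊖ v) ⊛ (const 1ℚ ⊖ v) ⊛ (const 1ℚ ⊖ v)))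

  N≋ : v ⊛ (α · v ⊕ const β)
         ⊛ ((3ℚ * β) · (v ⊛ v) ⊕ const (3ℚ * α) ⊕ (3ℚ * β) · v ⊕ α · v ⊕ α · (v ⊛ v) ⊕ α · (v ⊛ v ⊛ v))
       ≋ ⟪ P.N ⟫
  N≋ = ⊛-cong (⊛-congˡ v (⊕-cong (α· v) β≋))
              (⊕-cong (⊕-cong (⊕-cong (⊕-cong (⊕-cong (scale-≋ 3β≋ (v ⊛ v)) (const-* 3ℚ α)) (scale-≋ 3β≋ v))
                                      (α· v)) (α· (v ⊛ v))) (α· (v ⊛ v ⊛ v)))
    where
    α· : ∀ X → α · X ≋ const α ⊛ X
    α· X = ≋-sym (const-⊛ α X)
    3β≋ : const (3ℚ * β) ≋ const 3ℚ ⊛ ⟪ P.b ⟫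
    3β≋ = ≋-trans (const-* 3ℚ β) (⊛-congˡ (const 3ℚ) β≋)

α*[1-α]≢0 : ∀ {α} → 0ℚ < α → α < 1ℚ → α * (1ℚ - α) ≢ 0ℚ
α*[1-α]≢0 {α} 0<α α<1 αβ≡0 = ℚ.<-irrefl (≡.sym αβ≡0) (ℚ.positive⁻¹ (α * (1ℚ - α)))
  where
  instance
    _ = ℚ.positive 0<α
    _ = ℚ.positive (≡.subst (_< 1ℚ - α) (ℚ.+-inverseʳ α) (ℚ.+-monoˡ-< (- α) α<1))
    _ = ℚ.pos*pos⇒pos α (1ℚ - α)

mainTheorem2 : (α : ℚ) → 0ℚ < α → α < 1ℚ →
    let β = 1ℚ - α in
    (v : Series) → v 0 ≡ 0ℚ →
    (∀ n → (zS ⊛ ((const α ⊕ β · v) ⊛ (const β ⊕ α · v))) n ≡ v n) →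
    ∀ n → (E α ⊛ ((α * β) · ((const 1ℚ ⊖ v) ⊛ (const 1ℚ ⊖ v) ⊛ (const 1ℚ ⊖ v))
                  ⊛ (const 1ℚ ⊕ v ⊕ v ⊛ v))) n
          ≡ (v ⊛ (α · v ⊕ const β)
               ⊛ ((3ℚ * β) · (v ⊛ v) ⊕ const (3ℚ * α) ⊕ (3ℚ * β) · v
                  ⊕ α · v ⊕ α · (v ⊛ v) ⊕ α · (v ⊛ v ⊛ v))) n
mainTheorem2 α 0<α α<1 v v0 v-eq = coeff≡ (≋-trans (⊛-congˡ (E α) D≋) (≋-trans E⊛D≋N (≋-sym N≋)))
  where open ClosedForm α (α*[1-α]≢0 0<α α<1) v v0 (mk≋ v-eq)
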